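{- Let $G$ be a finite group of even order. Let $S=I(G)$ be the set of involutions of $G$, and let $O(C_G(S))$ denote the set of elements of odd order in $G$ that commute with every involution of $G$. Then (a) the power graph $P(G)$ has a matching leaving at most $\max\{0,\ |I(G)|-|O(C_G(S))|\}$ vertices unmatched; (b) if $|I(G)|\le |O(C_G(S))|$, then $P(G)$ has a perfect matching.
   Context: The power graph $P(G)$ of a finite group $G$ is the simple undirected graph with vertex set $G$ in which distinct $x,y$ are adjacent iff one is a power of the other. A matching is a set of pairwise vertex-disjoint edges; a perfect matching covers every vertex. -}

module Defs where

open import Data.Nat using (ℕ; zero; suc; _+_; _*_; _∸_; _<_; _≤_)
open import Data.Nat.Divisibility using (_∣_)
open import Data.Fin using (Fin)
open import Data.List using (List; []; _∷_; length; concatMap)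
open import Data.List.Membership.Propositional using (_∈_)
open import Data.List.Relation.Unary.All using (All)
open import Data.List.Relation.Unary.Unique.Propositional using (Unique)
open import Data.Product using (_×_; _,_; ∃; ∃-syntax)
open import Data.Sum using (_⊎_)
open import Relation.Binary.PropositionalEquality using (_≡_; _≢_)
open import Function.Bundles using (_⇔_)

-- A finite group, presented (up to isomorphism) on the carrier Fin order
-- by its multiplication table, identity and inverse, with the group laws.
record FiniteGroup : Set where
  field
    order : ℕ
    _·_   : Fin order → Fin order → Fin order
    e     : Fin order
    inv   : Fin order → Fin order
    assoc    : ∀ x y z → (x · y) · z ≡ x · (y · z)
    identityˡ : ∀ x → e · x ≡ x
    identityʳ : ∀ x → x · e ≡ x
    inverseˡ  : ∀ x → inv x · x ≡ e
    inverseʳ  : ∀ x → x · inv x ≡ e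

module _ (G : FiniteGroup) where
  open FiniteGroup G

  Elt : Set
  Elt = Fin order

  pow : Elt → ℕ → Elt
  pow x zero    = e
  pow x (suc k) = x · pow x k

  HasOrder : Elt → ℕ → Set
  HasOrder x m = 0 < m × pow x m ≡ e × (∀ k → 0 < k → k < m → pow x k ≢ e)

  Odd : ℕ → Set
  Odd m = ∃[ j ] m ≡ suc (2 * j)

  HasOddOrder : Elt → Set
  HasOddOrder x = ∃[ m ] (HasOrder x m × Odd m)

  Involution : Elt → Set
  Involution x = HasOrder x 2

  InOddCentralizerOfInvolutions : Elt → Set
  InOddCentralizerOfInvolutions x =
    HasOddOrder x × (∀ s → Involution s → x · s ≡ s · x)

  IsPowerOf : Elt → Elt → Set
  IsPowerOf y x = ∃[ k ] pow x k ≡ y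

  PowerAdj : Elt → Elt → Set
  PowerAdj x y = x ≢ y × (IsPowerOf x y ⊎ IsPowerOf y x)

  endpoints : List (Elt × Elt) → List Elt
  endpoints = concatMap (λ { (x , y) → x ∷ y ∷ [] })

  IsMatching : List (Elt × Elt) → Set
  IsMatching M = All (λ { (x , y) → PowerAdj x y }) M × Unique (endpoints M)

  unmatched : List (Elt × Elt) → ℕ
  unmatched M = order ∸ length (endpoints M)

  IsPerfectMatching : List (Elt × Elt) → Set
  IsPerfectMatching M = IsMatching M × (∀ x → x ∈ endpoints M)

-- L enumerates (without repetition) exactly the elements satisfying P;
-- so |{x | P x}| = length L.
Enumerates : {A : Set} → (A → Set) → List A → Set
Enumerates {A} P L = Unique L × (∀ x → (x ∈ L) ⇔ P x)

-- An element t · o with t² = e and o of odd order commuting with t determines both factors: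
-- raising it to an odd multiple of the order of o gives back t.  Moreover t is an odd power
-- and o an even power of t · o, so both are adjacent to t · o in the power graph.
-- Fix an involution t₀ and match it with e.  Choose one element q of each inverse pair
-- {q, q⁻¹} of non-trivial elements of O(C_G(S)), and give it two further involutions a and b;
-- the eight distinct elements a, aq, aq⁻¹, q⁻¹, b, bq⁻¹, bq, q are matched by the edges
-- a — aq, aq⁻¹ — q⁻¹, b — bq⁻¹, bq — q.  The matched set is closed under inversion, so every
-- other x with x² ≠ e can be matched with x⁻¹.  What remains are the involutions left over:
-- |I(G)| − 1 − 2k ≤ |I(G)| − |O(C_G(S))| of them when all k pairs were used (as
-- |O(C_G(S))| ≤ 1 + 2k), and at most one otherwise (or just e, when there is no involution);
-- in that case |G| being even forces the number of unmatched vertices to be 0.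

module Submission where

open import Defs
open import Level using (0ℓ)
open import Algebra.Bundles using (Group)
import Algebra.Properties.Group as GroupProperties
open import Data.Nat using (ℕ; zero; suc; _+_; _*_; _∸_; _<_; _≤_; z≤n; s≤s)
open import Data.Nat.Properties
  using (*-zeroʳ; *-suc; *-comm; +-suc; *-distribˡ-∸; <-cmp; <-irrefl; <-asym; _<?_; ≤-refl; ≤-reflexive; ≤-trans;
         1+n≰n; m≤n+m; m∸n≡0⇒m≤n; m≤n⇒∃[o]m+o≡n; m≤n+o⇒m∸n≤o; m+n∸m≡n; ∸-monoʳ-≤; n≤0⇒n≡0; m≤n⇒m∸n≡0)
open import Data.Nat.Divisibility using (_∣_; divides)
open import Data.Nat.Tactic.RingSolver using (solve-∀)
open import Data.Fin using (Fin; toℕ)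
open import Data.Fin.Properties using (pigeonhole; toℕ-injective; _≟_)
open import Data.Product using (_×_; _,_; ∃-syntax; <_,_>; proj₁; proj₂)
open import Data.Product.Properties using (,-injectiveˡ; ,-injectiveʳ)
open import Data.Sum as Sum using (_⊎_; inj₁; inj₂)
open import Data.Empty using (⊥-elim)
open import Function using (_∘_; id)
open import Function.Bundles using (Equivalence)
open import Relation.Binary.PropositionalEquality
open import Relation.Binary.Definitions using (tri<; tri≈; tri>)
open import Relation.Nullary using (¬_; ¬?; yes; no)
open import Relation.Nullary.Decidable using (_×-dec_)
open import Relation.Unary using (Decidable)
open import Data.List using (List; []; _∷_; length; map; _++_; concatMap; filter; allFin)
open import Data.List.Properties using (length-++; length-map; length-tabulate; concatMap-++; map-concatMap)
open import Data.List.Membership.Propositional using (_∈_; _∉_; find; lose)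
open import Data.List.Membership.Propositional.Properties
  using (∈-∃++; ∈-++⁻; ∈-++⁺ˡ; ∈-++⁺ʳ; ∈-allFin; ∈-filter⁺; ∈-filter⁻; ∈-concatMap⁺; ∈-concatMap⁻; ∈-map⁺; ∈-map⁻)
open import Data.List.Relation.Binary.Disjoint.Propositional using (Disjoint)
open import Data.List.Relation.Binary.Subset.Propositional using (_⊆_)
open import Data.List.Relation.Unary.Any using (here; there)
open import Data.List.Relation.Unary.All as All using (All; []; _∷_)
import Data.List.Relation.Unary.All.Properties as All
open import Data.List.Relation.Unary.AllPairs using (AllPairs; []; _∷_)
open import Data.List.Relation.Unary.Unique.Propositional using (Unique)
open import Data.List.Relation.Unary.Unique.Propositional.Properties using (allFin⁺; filter⁺; ++⁺)

odd*odd : ∀ i j → ∃[ k ] suc (2 * i) * suc (2 * j) ≡ suc (2 * k)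
odd*odd i j = j + i * suc (2 * j) , lemma i j
  where
  lemma : ∀ i j → suc (2 * i) * suc (2 * j) ≡ suc (2 * (j + i * suc (2 * j)))
  lemma = solve-∀

even∸even≤1⇒≡0 : ∀ {n} k → 2 ∣ n → n ∸ 2 * k ≤ 1 → n ∸ 2 * k ≡ 0
even∸even≤1⇒≡0 {n} k (divides c refl) ≤1 =
  subst (_≡ 0) 2*[c∸k]≡n∸2*k (double≤1⇒≡0 (c ∸ k) (subst (_≤ 1) (sym 2*[c∸k]≡n∸2*k) ≤1))
  where
  2*[c∸k]≡n∸2*k : 2 * (c ∸ k) ≡ c * 2 ∸ 2 * k
  2*[c∸k]≡n∸2*k = trans (*-distribˡ-∸ 2 c k) (cong (_∸ 2 * k) (*-comm 2 c))
  double≤1⇒≡0 : ∀ d → 2 * d ≤ 1 → 2 * d ≡ 0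
  double≤1⇒≡0 zero    _    = refl
  double≤1⇒≡0 (suc d) 2d≤1 with s≤s () ← subst (_≤ 1) (*-suc 2 d) 2d≤1

private
  variable
    A B : Set

vertices : List (A × A) → List A
vertices = concatMap (λ (x , y) → x ∷ y ∷ [])

length-vertices : (xs : List (A × A)) → length (vertices xs) ≡ 2 * length xs
length-vertices []       = refl
length-vertices (_ ∷ xs) = trans (cong (2 +_) (length-vertices xs)) (sym (*-suc 2 (length xs)))

vertices-++ : (xs ys : List (A × A)) → vertices (xs ++ ys) ≡ vertices xs ++ vertices ys
vertices-++ = concatMap-++ _

vertices-concatMap : (f : A → List (B × B)) (xs : List A) →
                     vertices (concatMap f xs) ≡ concatMap (λ x → vertices (f x)) xs
vertices-concatMap f []       = refl
vertices-concatMap f (x ∷ xs) = trans (concatMap-++ _ (f x) (concatMap f xs))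
                                      (cong (vertices (f x) ++_) (vertices-concatMap f xs))

map⁺-injectiveOn : {P : A → Set} {f : A → B} → (∀ {x y} → P x → P y → f x ≡ f y → x ≡ y) →
                   {xs : List A} → All P xs → Unique xs → Unique (map f xs)
map⁺-injectiveOn inj []         []           = []
map⁺-injectiveOn inj (px ∷ pxs) (x∉xs ∷ uxs) =
  All.map⁺ (All.zipWith (λ (py , x≢y) fx≡fy → x≢y (inj px py fx≡fy)) (pxs , x∉xs)) ∷
  map⁺-injectiveOn inj pxs uxs

unique-⊆⇒length≤ : {xs ys : List A} → Unique xs → xs ⊆ ys → length xs ≤ length ys
unique-⊆⇒length≤ {xs = []}     _            _      = z≤n
unique-⊆⇒length≤ {xs = x ∷ xs} (x∉xs ∷ uxs) x∷xs⊆ys with ∈-∃++ (x∷xs⊆ys (here refl))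
... | us , ws , refl = subst (suc (length xs) ≤_) length-removed (s≤s (unique-⊆⇒length≤ uxs xs⊆us++ws))
  where
  length-removed : suc (length (us ++ ws)) ≡ length (us ++ x ∷ ws)
  length-removed = trans (cong suc (length-++ us)) (trans (sym (+-suc _ _)) (sym (length-++ us)))
  xs⊆us++ws : xs ⊆ us ++ ws
  xs⊆us++ws {y} y∈xs with ∈-++⁻ us (x∷xs⊆ys (there y∈xs))
  ... | inj₁ y∈us          = ∈-++⁺ˡ y∈us
  ... | inj₂ (here y≡x)    = ⊥-elim (All.lookup x∉xs y∈xs (sym y≡x))
  ... | inj₂ (there y∈ws)  = ∈-++⁺ʳ us y∈ws

module _ {n : ℕ} where

  open import Data.List.Membership.DecPropositional (_≟_ {n}) using (_∈?_)

  unique⇒length≤ : {xs : List (Fin n)} → Unique xs → length xs ≤ n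
  unique⇒length≤ {xs} uxs = subst (length xs ≤_) (length-tabulate id) (unique-⊆⇒length≤ uxs (λ {x} _ → ∈-allFin x))

  covering⇒≤ : (xs ys : List (Fin n)) → (∀ x → x ∈ xs ⊎ x ∈ ys) → n ≤ length xs + length ys
  covering⇒≤ xs ys cover = subst₂ _≤_ (length-tabulate id) (length-++ xs)
    (unique-⊆⇒length≤ (allFin⁺ n) (λ {x} _ → Sum.[ ∈-++⁺ˡ , ∈-++⁺ʳ xs ]′ (cover x)))

  unique∧∸length≡0⇒∈ : {xs : List (Fin n)} → Unique xs → n ∸ length xs ≡ 0 → ∀ x → x ∈ xs
  unique∧∸length≡0⇒∈ {xs} uxs n∸|xs|≡0 x with x ∈? xs
  ... | yes x∈xs = x∈xs
  ... | no  x∉xs = ⊥-elim (1+n≰n (≤-trans (unique⇒length≤ (All.¬Any⇒All¬ xs x∉xs ∷ uxs)) (m∸n≡0⇒m≤n n∸|xs|≡0)))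

module InvolutionPairing {n : ℕ} (f : Fin n → Fin n) (f-involutive : ∀ x → f (f x) ≡ x) where

  Below : Fin n → Set
  Below x = toℕ x < toℕ (f x)

  below? : Decidable Below
  below? x = toℕ x <? toℕ (f x)

  pairWith : List (Fin n) → List (Fin n × Fin n)
  pairWith = map < id , f >

  f-injective : ∀ {x y} → f x ≡ f y → x ≡ y
  f-injective {x} {y} fx≡fy = trans (sym (f-involutive x)) (trans (cong f fx≡fy) (f-involutive y))

  below⇒≢ : ∀ {x} → Below x → x ≢ f x
  below⇒≢ x<fx x≡fx = <-irrefl (cong toℕ x≡fx) x<fx

  below-asym : ∀ {x} → Below x → ¬ Below (f x)
  below-asym {x} x<fx fx<ffx = <-asym x<fx (subst (λ z → toℕ (f x) < toℕ z) (f-involutive x) fx<ffx)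

  ∈-pairWith⁻ : ∀ {v xs} → v ∈ vertices (pairWith xs) → ∃[ x ] x ∈ xs × (v ≡ x ⊎ v ≡ f x)
  ∈-pairWith⁻ {xs = x ∷ xs} (here v≡x)         = x , here refl , inj₁ v≡x
  ∈-pairWith⁻ {xs = x ∷ xs} (there (here v≡fx)) = x , here refl , inj₂ v≡fx
  ∈-pairWith⁻ {xs = x ∷ xs} (there (there v∈))  with ∈-pairWith⁻ v∈
  ... | y , y∈xs , v≡y⊎fy = y , there y∈xs , v≡y⊎fy

  ∈-pairWith⁺ : ∀ {x xs} → x ∈ xs → x ∈ vertices (pairWith xs) × f x ∈ vertices (pairWith xs)
  ∈-pairWith⁺ (here refl) = here refl , there (here refl)
  ∈-pairWith⁺ (there x∈xs) with ∈-pairWith⁺ x∈xs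
  ... | x∈ , fx∈ = there (there x∈) , there (there fx∈)

  ∈-pairWith-filter : ∀ {x xs} → x ≢ f x → x ∈ xs → f x ∈ xs → x ∈ vertices (pairWith (filter below? xs))
  ∈-pairWith-filter {x} x≢fx x∈xs fx∈xs with <-cmp (toℕ x) (toℕ (f x))
  ... | tri< x<fx _ _ = proj₁ (∈-pairWith⁺ (∈-filter⁺ below? x∈xs x<fx))
  ... | tri≈ _ x≡fx _ = ⊥-elim (x≢fx (toℕ-injective x≡fx))
  ... | tri> _ _ fx<x = subst (_∈ _) (f-involutive x)
    (proj₂ (∈-pairWith⁺ (∈-filter⁺ below? fx∈xs (subst (λ z → toℕ (f x) < toℕ z) (sym (f-involutive x)) fx<x))))

  pairWith-unique : ∀ {xs} → Unique xs → All Below xs → Unique (vertices (pairWith xs))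
  pairWith-unique {[]}     []           []         = []
  pairWith-unique {x ∷ xs} (x∉xs ∷ uxs) (bx ∷ bxs) =
    (below⇒≢ bx ∷ All.¬Any⇒All¬ _ x∉) ∷ All.¬Any⇒All¬ _ fx∉ ∷ pairWith-unique uxs bxs
    where
    x∉ : x ∉ vertices (pairWith xs)
    x∉ x∈ with ∈-pairWith⁻ x∈
    ... | y , y∈xs , inj₁ x≡y  = All.lookup x∉xs y∈xs x≡y
    ... | y , y∈xs , inj₂ x≡fy = below-asym (All.lookup bxs y∈xs) (subst Below x≡fy bx)
    fx∉ : f x ∉ vertices (pairWith xs)
    fx∉ fx∈ with ∈-pairWith⁻ fx∈
    ... | y , y∈xs , inj₁ fx≡y  = below-asym bx (subst Below (sym fx≡y) (All.lookup bxs y∈xs))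
    ... | y , y∈xs , inj₂ fx≡fy = All.lookup x∉xs y∈xs (f-injective fx≡fy)

asGroup : FiniteGroup → Group 0ℓ 0ℓ
asGroup G = record
  { isGroup = record
    { isMonoid = record
      { isSemigroup = record
        { isMagma = record { isEquivalence = isEquivalence ; ∙-cong = cong₂ _·_ }
        ; assoc = assoc
        }
      ; identity = identityˡ , identityʳ
      }
    ; inverse = inverseˡ , inverseʳ
    ; ⁻¹-cong = cong inv
    }
  }
  where open FiniteGroup G

module GroupTheory (G : FiniteGroup) where
  open FiniteGroup G
  open GroupProperties (asGroup G) public
    using (∙-cancelˡ; ∙-cancelʳ; inverseʳ-unique; ε⁻¹≈ε; ⁻¹-involutive; ⁻¹-injective; ⁻¹-anti-homo-∙)
  open ≡-Reasoning

  infixr 30 _^_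
  _^_ : Elt G → ℕ → Elt G
  _^_ = pow G

  Commute : Elt G → Elt G → Set
  Commute x y = x · y ≡ y · x

  ^-distribˡ-+-· : ∀ x m n → x ^ (m + n) ≡ x ^ m · x ^ n
  ^-distribˡ-+-· x zero    n = sym (identityˡ _)
  ^-distribˡ-+-· x (suc m) n = trans (cong (x ·_) (^-distribˡ-+-· x m n)) (sym (assoc _ _ _))

  e^n≡e : ∀ n → e ^ n ≡ e
  e^n≡e zero    = refl
  e^n≡e (suc n) = trans (identityˡ _) (e^n≡e n)

  ^-*-assoc : ∀ x m n → (x ^ m) ^ n ≡ x ^ (m * n)
  ^-*-assoc x m zero    = cong (x ^_) (sym (*-zeroʳ m))
  ^-*-assoc x m (suc n) = begin
    x ^ m · (x ^ m) ^ n  ≡⟨ cong (x ^ m ·_) (^-*-assoc x m n) ⟩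
    x ^ m · x ^ (m * n)  ≡⟨ ^-distribˡ-+-· x m (m * n) ⟨
    x ^ (m + m * n)      ≡⟨ cong (x ^_) (*-suc m n) ⟨
    x ^ (m * suc n)      ∎

  commute-^ : ∀ {x y} k → Commute x y → Commute (x ^ k) y
  commute-^ {x} {y} zero    _  = trans (identityˡ y) (sym (identityʳ y))
  commute-^ {x} {y} (suc k) xy = begin
    (x · x ^ k) · y  ≡⟨ assoc _ _ _ ⟩
    x · (x ^ k · y)  ≡⟨ cong (x ·_) (commute-^ k xy) ⟩
    x · (y · x ^ k)  ≡⟨ assoc _ _ _ ⟨
    (x · y) · x ^ k  ≡⟨ cong (_· x ^ k) xy ⟩
    (y · x) · x ^ k  ≡⟨ assoc _ _ _ ⟩
    y · (x · x ^ k)  ∎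

  ^-distribʳ-· : ∀ {x y} k → Commute x y → (x · y) ^ k ≡ x ^ k · y ^ k
  ^-distribʳ-· zero    _  = sym (identityˡ e)
  ^-distribʳ-· {x} {y} (suc k) xy = begin
    (x · y) · (x · y) ^ k      ≡⟨ cong ((x · y) ·_) (^-distribʳ-· k xy) ⟩
    (x · y) · (x ^ k · y ^ k)  ≡⟨ assoc _ _ _ ⟩
    x · (y · (x ^ k · y ^ k))  ≡⟨ cong (x ·_) (assoc _ _ _) ⟨
    x · ((y · x ^ k) · y ^ k)  ≡⟨ cong (λ z → x · (z · y ^ k)) (commute-^ k xy) ⟨
    x · ((x ^ k · y) · y ^ k)  ≡⟨ cong (x ·_) (assoc _ _ _) ⟩
    x · (x ^ k · (y · y ^ k))  ≡⟨ assoc _ _ _ ⟨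
    (x · x ^ k) · (y · y ^ k)  ∎

  inv-^ : ∀ x k → inv x ^ k ≡ inv (x ^ k)
  inv-^ x zero    = sym ε⁻¹≈ε
  inv-^ x (suc k) = begin
    inv x · inv x ^ k    ≡⟨ cong (inv x ·_) (inv-^ x k) ⟩
    inv x · inv (x ^ k)  ≡⟨ ⁻¹-anti-homo-∙ (x ^ k) x ⟨
    inv (x ^ k · x)      ≡⟨ cong inv (commute-^ k refl) ⟩
    inv (x · x ^ k)      ∎

  commute-inv : ∀ {x y} → Commute x y → Commute x (inv y)
  commute-inv {x} {y} xy = ∙-cancelˡ y _ _ (begin
    y · (x · inv y)  ≡⟨ assoc _ _ _ ⟨
    (y · x) · inv y  ≡⟨ cong (_· inv y) xy ⟨
    (x · y) · inv y  ≡⟨ assoc _ _ _ ⟩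
    x · (y · inv y)  ≡⟨ cong (x ·_) (inverseʳ y) ⟩
    x · e            ≡⟨ identityʳ x ⟩
    x                ≡⟨ identityˡ x ⟨
    e · x            ≡⟨ cong (_· x) (inverseʳ y) ⟨
    (y · inv y) · x  ≡⟨ assoc _ _ _ ⟩
    y · (inv y · x)  ∎)

  finite-order : ∀ x → ∃[ d ] x ^ suc d ≡ e
  finite-order x with pigeonhole ≤-refl (λ (i : Fin (suc order)) → x ^ toℕ i)
  ... | i , j , i<j , xⁱ≡xʲ with m≤n⇒∃[o]m+o≡n i<j
  ... | d , i+1+d≡j = d , sym (∙-cancelˡ (x ^ toℕ i) e (x ^ suc d) (begin
    x ^ toℕ i · e            ≡⟨ identityʳ _ ⟩
    x ^ toℕ i                ≡⟨ xⁱ≡xʲ ⟩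
    x ^ toℕ j                ≡⟨ cong (x ^_) (trans (+-suc (toℕ i) d) i+1+d≡j) ⟨
    x ^ (toℕ i + suc d)      ≡⟨ ^-distribˡ-+-· x (toℕ i) (suc d) ⟩
    x ^ toℕ i · x ^ suc d    ∎))

  inv-isPowerOf : ∀ x → IsPowerOf G (inv x) x
  inv-isPowerOf x with finite-order x
  ... | d , xᵈ⁺¹≡e = d , inverseʳ-unique x (x ^ d) xᵈ⁺¹≡e

  square≡e⇒^even≡e : ∀ {t} j → t · t ≡ e → t ^ (2 * j) ≡ e
  square≡e⇒^even≡e {t} j t²≡e = begin
    t ^ (2 * j)    ≡⟨ ^-*-assoc t 2 j ⟨
    (t · t ^ 1) ^ j  ≡⟨ cong (λ z → (t · z) ^ j) (identityʳ t) ⟩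
    (t · t) ^ j    ≡⟨ cong (_^ j) t²≡e ⟩
    e ^ j          ≡⟨ e^n≡e j ⟩
    e              ∎

  square≡e⇒^odd≡id : ∀ {t} j → t · t ≡ e → t ^ suc (2 * j) ≡ t
  square≡e⇒^odd≡id {t} j t²≡e = trans (cong (t ·_) (square≡e⇒^even≡e j t²≡e)) (identityʳ t)

  involution⇒ : ∀ {x} → Involution G x → x · x ≡ e × x ≢ e
  involution⇒ {x} (_ , x²≡e , minimal) =
    trans (cong (x ·_) (sym (identityʳ x))) x²≡e ,
    λ x≡e → minimal 1 (s≤s z≤n) (s≤s (s≤s z≤n)) (trans (identityʳ x) x≡e)

  involution⇐ : ∀ {x} → x · x ≡ e → x ≢ e → Involution G x
  involution⇐ {x} x·x≡e x≢e = s≤s z≤n , trans (cong (x ·_) (identityʳ x)) x·x≡e , minimal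
    where
    minimal : ∀ k → 0 < k → k < 2 → x ^ k ≢ e
    minimal (suc zero) _ _ = λ x¹≡e → x≢e (trans (sym (identityʳ x)) x¹≡e)
    minimal (suc (suc k)) _ (s≤s (s≤s ()))

  square≡e⇒≡e⊎involution : ∀ {x} → x · x ≡ e → x ≡ e ⊎ Involution G x
  square≡e⇒≡e⊎involution {x} x²≡e with x ≟ e
  ... | yes x≡e = inj₁ x≡e
  ... | no  x≢e = inj₂ (involution⇐ x²≡e x≢e)

  OddTorsion : Elt G → Set
  OddTorsion o = ∃[ j ] o ^ suc (2 * j) ≡ e

  hasOddOrder⇒oddTorsion : ∀ {o} → HasOddOrder G o → OddTorsion o
  hasOddOrder⇒oddTorsion (_ , (_ , oᵐ≡e , _) , j , refl) = j , oᵐ≡e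

  oddTorsion-e : OddTorsion e
  oddTorsion-e = 0 , identityˡ e

  oddTorsion-inv : ∀ {o} → OddTorsion o → OddTorsion (inv o)
  oddTorsion-inv {o} (j , oᵐ≡e) = j , trans (inv-^ o (suc (2 * j))) (trans (cong inv oᵐ≡e) ε⁻¹≈ε)

  oddTorsion-≢inv : ∀ {o} → OddTorsion o → o ≢ e → o ≢ inv o
  oddTorsion-≢inv {o} (j , oᵐ≡e) o≢e o≡o⁻¹ =
    o≢e (trans (sym (square≡e⇒^odd≡id j o·o≡e)) oᵐ≡e)
    where
    o·o≡e : o · o ≡ e
    o·o≡e = trans (cong (o ·_) o≡o⁻¹) (inverseʳ o)

  inOddCentralizer-inv : ∀ {o} → InOddCentralizerOfInvolutions G o → InOddCentralizerOfInvolutions G (inv o)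
  inOddCentralizer-inv {o} ((m , (0<m , oᵐ≡e , minimal) , odd) , central) =
    (m , (0<m , trans (inv-^ o m) (trans (cong inv oᵐ≡e) ε⁻¹≈ε) , minimal⁻¹) , odd) ,
    λ s s-inv → sym (commute-inv (sym (central s s-inv)))
    where
    minimal⁻¹ : ∀ k → 0 < k → k < m → inv o ^ k ≢ e
    minimal⁻¹ k 0<k k<m o⁻ᵏ≡e = minimal k 0<k k<m
      (⁻¹-injective (trans (sym (inv-^ o k)) (trans o⁻ᵏ≡e (sym ε⁻¹≈ε))))

  IsFactorisation : Elt G × Elt G → Set
  IsFactorisation (t , o) = t · t ≡ e × OddTorsion o × Commute t o

  enc : Elt G × Elt G → Elt G
  enc (t , o) = t · o

  enc-inv : ∀ {t o} → IsFactorisation (t , o) → inv (enc (t , o)) ≡ enc (t , inv o)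
  enc-inv {t} {o} (t²≡e , _ , to≡ot) = begin
    inv (t · o)      ≡⟨ ⁻¹-anti-homo-∙ t o ⟩
    inv o · inv t    ≡⟨ cong (inv o ·_) (inverseʳ-unique t t t²≡e) ⟨
    inv o · t        ≡⟨ commute-inv to≡ot ⟨
    t · inv o        ∎

  factorisation-·e : ∀ {t} → t · t ≡ e → IsFactorisation (t , e)
  factorisation-·e {t} t²≡e = t²≡e , oddTorsion-e , trans (identityʳ t) (sym (identityˡ t))

  factorisation-e· : ∀ {o} → OddTorsion o → IsFactorisation (e , o)
  factorisation-e· {o} odd = identityˡ e , odd , trans (identityˡ o) (sym (identityʳ o))

  factorisation-^odd : ∀ {t o} → IsFactorisation (t , o) → ∀ k → o ^ suc (2 * k) ≡ e →
                           (t · o) ^ suc (2 * k) ≡ t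
  factorisation-^odd {t} {o} (t²≡e , _ , to≡ot) k oⁿ≡e = begin
    (t · o) ^ n      ≡⟨ ^-distribʳ-· n to≡ot ⟩
    t ^ n · o ^ n    ≡⟨ cong₂ _·_ (square≡e⇒^odd≡id k t²≡e) oⁿ≡e ⟩
    t · e            ≡⟨ identityʳ t ⟩
    t                ∎
    where n = suc (2 * k)

  factorisation-^even : ∀ {t o} → IsFactorisation (t , o) → ∀ k → o ^ suc (2 * k) ≡ e →
                            (t · o) ^ (2 * suc k) ≡ o
  factorisation-^even {t} {o} (t²≡e , _ , to≡ot) k oⁿ≡e = begin
    (t · o) ^ (2 * suc k)          ≡⟨ ^-distribʳ-· (2 * suc k) to≡ot ⟩
    t ^ (2 * suc k) · o ^ (2 * suc k)  ≡⟨ cong₂ _·_ (square≡e⇒^even≡e (suc k) t²≡e) (cong (o ^_) (*-suc 2 k)) ⟩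
    e · o ^ suc (suc (2 * k))      ≡⟨ identityˡ _ ⟩
    o · o ^ suc (2 * k)            ≡⟨ cong (o ·_) oⁿ≡e ⟩
    o · e                          ≡⟨ identityʳ o ⟩
    o                              ∎

  factorisation-unique : ∀ {t o t′ o′} → IsFactorisation (t , o) → IsFactorisation (t′ , o′) →
                         t · o ≡ t′ · o′ → (t , o) ≡ (t′ , o′)
  factorisation-unique {t} {o} {t′} {o′} f@(_ , (i , oᵐ≡e) , _) f′@(_ , (j , o′ᵐ′≡e) , _) to≡t′o′
    with odd*odd i j
  ... | k , m*m′≡n = cong₂ _,_ t≡t′ (∙-cancelˡ t o o′ (trans to≡t′o′ (cong (_· o′) (sym t≡t′))))
    where
    m = suc (2 * i)
    m′ = suc (2 * j)
    n = suc (2 * k)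
    killed : ∀ {x} p q → x ^ p ≡ e → x ^ (p * q) ≡ e
    killed {x} p q xᵖ≡e = trans (sym (^-*-assoc x p q)) (trans (cong (_^ q) xᵖ≡e) (e^n≡e q))
    t≡t′ : t ≡ t′
    t≡t′ = begin
      t              ≡⟨ factorisation-^odd f k (subst (λ z → o ^ z ≡ e) m*m′≡n (killed m m′ oᵐ≡e)) ⟨
      (t · o) ^ n    ≡⟨ cong (_^ n) to≡t′o′ ⟩
      (t′ · o′) ^ n  ≡⟨ factorisation-^odd f′ k
                          (subst (λ z → o′ ^ z ≡ e) (trans (*-comm m′ m) m*m′≡n) (killed m′ m o′ᵐ′≡e)) ⟩
      t′             ∎

  adjacent-inv : ∀ {x} → x · x ≢ e → PowerAdj G x (inv x)
  adjacent-inv {x} x²≢e = (λ x≡x⁻¹ → x²≢e (trans (cong (x ·_) x≡x⁻¹) (inverseʳ x))) , inj₂ (inv-isPowerOf x)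

  adjacent-involutionPart : ∀ {t o} → IsFactorisation (t , o) → o ≢ e → PowerAdj G (t · e) (t · o)
  adjacent-involutionPart {t} {o} f@(_ , (j , oᵐ≡e) , _) o≢e =
    (λ te≡to → o≢e (sym (∙-cancelˡ t e o te≡to))) ,
    inj₁ (suc (2 * j) , trans (factorisation-^odd f j oᵐ≡e) (sym (identityʳ t)))

  adjacent-oddPart : ∀ {t o} → IsFactorisation (t , o) → t ≢ e → PowerAdj G (t · o) (e · o)
  adjacent-oddPart {t} {o} f@(_ , (j , oᵐ≡e) , _) t≢e =
    (λ to≡eo → t≢e (∙-cancelʳ o t e to≡eo)) ,
    inj₂ (2 * suc j , trans (factorisation-^even f j oᵐ≡e) (sym (identityˡ o)))

module PowerGraphMatching (G : FiniteGroup) where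
  open FiniteGroup G
  open GroupTheory G
  open InvolutionPairing inv ⁻¹-involutive

  open import Data.List.Membership.DecPropositional (_≟_ {order}) using (_∈?_)

  module InverseExtension (B : List (Elt G × Elt G)) (B-matching : IsMatching G B)
                          (B-closed : ∀ {x} → x ∈ vertices B → inv x ∈ vertices B) where

    private
      Free : Elt G → Set
      Free x = x ∉ vertices B × x · x ≢ e

      free? : Decidable Free
      free? x = ¬? (x ∈? vertices B) ×-dec ¬? (x · x ≟ e)

      candidates = filter free? (allFin order)

      P : List (Elt G × Elt G)
      P = pairWith (filter below? candidates)

      free-below : ∀ {x} → x ∈ filter below? candidates → Free x
      free-below x∈ = proj₂ (∈-filter⁻ free? {xs = allFin order} (proj₁ (∈-filter⁻ below? {xs = candidates} x∈)))

      P-adjacent : All (λ (x , y) → PowerAdj G x y) P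
      P-adjacent = All.map⁺ (All.tabulate (λ x∈ → adjacent-inv (proj₂ (free-below x∈))))

      P-unique : Unique (vertices P)
      P-unique = pairWith-unique (filter⁺ below? (filter⁺ free? (allFin⁺ order)))
                                 (All.all-filter below? candidates)

      B-P-disjoint : ∀ {v} → v ∈ vertices B → v ∉ vertices P
      B-P-disjoint v∈B v∈P with ∈-pairWith⁻ v∈P
      ... | x , x∈ , inj₁ refl = proj₁ (free-below x∈) v∈B
      ... | x , x∈ , inj₂ refl = proj₁ (free-below x∈) (subst (_∈ vertices B) (⁻¹-involutive x) (B-closed v∈B))

    extended : List (Elt G × Elt G)
    extended = B ++ P

    extended-isMatching : IsMatching G extended
    extended-isMatching =
      All.++⁺ (proj₁ B-matching) P-adjacent ,
      subst Unique (sym (vertices-++ B P)) (++⁺ (proj₂ B-matching) P-unique (λ (v∈B , v∈P) → B-P-disjoint v∈B v∈P))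

    extended-⊇ : ∀ {x} → x ∈ vertices B → x ∈ vertices extended
    extended-⊇ x∈B = subst (_ ∈_) (sym (vertices-++ B P)) (∈-++⁺ˡ x∈B)

    extended-cover : ∀ x → x ∈ vertices extended ⊎ x · x ≡ e
    extended-cover x with x ∈? vertices B | x · x ≟ e
    ... | yes x∈B | _         = inj₁ (extended-⊇ x∈B)
    ... | no  _   | yes x²≡e  = inj₂ x²≡e
    ... | no  x∉B | no  x²≢e  = inj₁ (subst (_ ∈_) (sym (vertices-++ B P)) (∈-++⁺ʳ (vertices B)
        (∈-pairWith-filter (λ x≡x⁻¹ → x²≢e (trans (cong (x ·_) x≡x⁻¹) (inverseʳ x)))
          (∈-filter⁺ free? (∈-allFin x) (x∉B , x²≢e))
          (∈-filter⁺ free? (∈-allFin (inv x)) (x⁻¹∉B , x⁻²≢e)))))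
      where
      x⁻¹∉B : inv x ∉ vertices B
      x⁻¹∉B x⁻¹∈B = x∉B (subst (_∈ vertices B) (⁻¹-involutive x) (B-closed x⁻¹∈B))
      x⁻²≢e : inv x · inv x ≢ e
      x⁻²≢e x⁻²≡e = x²≢e (⁻¹-injective (trans (⁻¹-anti-homo-∙ x x) (trans x⁻²≡e (sym ε⁻¹≈ε))))

  Assignable : Elt G × Elt G → Set
  Assignable (t , c) = Involution G t × InOddCentralizerOfInvolutions G c × c ≢ e

  Apart : Elt G × Elt G → Elt G × Elt G → Set
  Apart (t , c) (t′ , c′) = t ≢ t′ × c ≢ c′

  -- A pair (t , c) assigns the involution t to c; it contributes the edges t — tc and tc⁻¹ — c⁻¹,
  -- whose ends are the products enc of the four factorisations in tagsOf (t , c).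
  tagsOf : Elt G × Elt G → List (Elt G × Elt G)
  tagsOf (t , c) = (t , e) ∷ (t , c) ∷ (t , inv c) ∷ (e , inv c) ∷ []

  edgesOf : Elt G × Elt G → List (Elt G × Elt G)
  edgesOf (t , c) = (enc (t , e) , enc (t , c)) ∷ (enc (t , inv c) , enc (e , inv c)) ∷ []

  tagsOf-factorisation : ∀ {a} → Assignable a → All IsFactorisation (tagsOf a)
  tagsOf-factorisation {t , c} (t-inv , (c-odd , c-central) , _) =
    factorisation-·e t²≡e ∷ (t²≡e , c-oddTorsion , sym (c-central t t-inv)) ∷
    (t²≡e , oddTorsion-inv c-oddTorsion , commute-inv (sym (c-central t t-inv))) ∷
    factorisation-e· (oddTorsion-inv c-oddTorsion) ∷ []
    where
    t²≡e = proj₁ (involution⇒ t-inv)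
    c-oddTorsion = hasOddOrder⇒oddTorsion c-odd

  edgesOf-adjacent : ∀ {a} → Assignable a → All (λ (x , y) → PowerAdj G x y) (edgesOf a)
  edgesOf-adjacent {t , c} a-ok@(t-inv , _ , c≢e) with tagsOf-factorisation a-ok
  ... | _ ∷ tc ∷ tc⁻¹ ∷ _ = adjacent-involutionPart tc c≢e ∷ adjacent-oddPart tc⁻¹ (proj₂ (involution⇒ t-inv)) ∷ []

  ∈-tagsOf⁻ : ∀ {x t c} → x ∈ tagsOf (t , c) → proj₁ x ≡ t ⊎ (proj₁ x ≡ e × proj₂ x ≡ inv c)
  ∈-tagsOf⁻ (here refl)                         = inj₁ refl
  ∈-tagsOf⁻ (there (here refl))                 = inj₁ refl
  ∈-tagsOf⁻ (there (there (here refl)))         = inj₁ refl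
  ∈-tagsOf⁻ (there (there (there (here refl)))) = inj₂ (refl , refl)

  tagsOf-unique : ∀ {a} → Assignable a → Unique (tagsOf a)
  tagsOf-unique {t , c} (t-inv , (c-odd , _) , c≢e) =
    (on₂ (c≢e ∘ sym) ∷ on₂ (c⁻¹≢e ∘ sym) ∷ on₁ t≢e ∷ []) ∷
    (on₂ (oddTorsion-≢inv (hasOddOrder⇒oddTorsion c-odd) c≢e) ∷ on₁ t≢e ∷ []) ∷
    (on₁ t≢e ∷ []) ∷ [] ∷ []
    where
    t≢e = proj₂ (involution⇒ t-inv)
    c⁻¹≢e : inv c ≢ e
    c⁻¹≢e c⁻¹≡e = c≢e (⁻¹-injective (trans c⁻¹≡e (sym ε⁻¹≈ε)))
    on₁ : ∀ {x x′ y y′ : Elt G} → x ≢ x′ → (x , y) ≢ (x′ , y′)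
    on₁ x≢x′ = x≢x′ ∘ ,-injectiveˡ
    on₂ : ∀ {x x′ y y′ : Elt G} → y ≢ y′ → (x , y) ≢ (x′ , y′)
    on₂ y≢y′ = y≢y′ ∘ ,-injectiveʳ

  tagsOf-disjoint : ∀ {a b} → Assignable a → Assignable b → Apart a b → Disjoint (tagsOf a) (tagsOf b)
  tagsOf-disjoint (a-inv , _) (b-inv , _) (t≢t′ , c≢c′) (x∈a , x∈b) with ∈-tagsOf⁻ x∈a | ∈-tagsOf⁻ x∈b
  ... | inj₁ x≡t        | inj₁ x≡t′        = t≢t′ (trans (sym x≡t) x≡t′)
  ... | inj₁ x≡t        | inj₂ (x≡e , _)   = proj₂ (involution⇒ a-inv) (trans (sym x≡t) x≡e)
  ... | inj₂ (x≡e , _)  | inj₁ x≡t′        = proj₂ (involution⇒ b-inv) (trans (sym x≡t′) x≡e)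
  ... | inj₂ (_ , y≡c⁻¹) | inj₂ (_ , y≡c′⁻¹) = c≢c′ (⁻¹-injective (trans (sym y≡c⁻¹) y≡c′⁻¹))

  tags : List (Elt G × Elt G) → List (Elt G × Elt G)
  tags = concatMap tagsOf

  ∈-tags⁻ : ∀ {x as} → x ∈ tags as → ∃[ a ] a ∈ as × x ∈ tagsOf a
  ∈-tags⁻ = find ∘ ∈-concatMap⁻ tagsOf

  ∈-tags⁺ : ∀ {x a as} → a ∈ as → x ∈ tagsOf a → x ∈ tags as
  ∈-tags⁺ a∈as x∈a = ∈-concatMap⁺ tagsOf (lose a∈as x∈a)

  tags-unique : ∀ {as} → All Assignable as → AllPairs Apart as → Unique (tags as)
  tags-unique []               []                = []
  tags-unique (a-ok ∷ as-ok) (a-apart ∷ as-apart) =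
    ++⁺ (tagsOf-unique a-ok) (tags-unique as-ok as-apart) λ (x∈a , x∈as) →
      let b , b∈as , x∈b = ∈-tags⁻ x∈as
      in tagsOf-disjoint a-ok (All.lookup as-ok b∈as) (All.lookup a-apart b∈as) (x∈a , x∈b)

  tags-inverseClosed : ∀ {as} → (∀ {t c} → (t , c) ∈ as → ∃[ t′ ] (t′ , inv c) ∈ as) →
                       ∀ {x} → x ∈ tags as → (proj₁ x , inv (proj₂ x)) ∈ tags as
  tags-inverseClosed closed x∈as with ∈-tags⁻ x∈as
  ... | (t , c) , a∈as , here refl = ∈-tags⁺ a∈as (here (cong (t ,_) ε⁻¹≈ε))
  ... | (t , c) , a∈as , there (here refl) = ∈-tags⁺ a∈as (there (there (here refl)))
  ... | (t , c) , a∈as , there (there (here refl)) = ∈-tags⁺ a∈as (there (here (cong (t ,_) (⁻¹-involutive c))))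
  ... | (t , c) , a∈as , there (there (there (here refl))) =
    let t′ , a′∈as = closed a∈as in ∈-tags⁺ a′∈as (there (there (there (here refl))))

  record IsAssignment (t₀ : Elt G) (as : List (Elt G × Elt G)) : Set where
    field
      t₀-involution  : Involution G t₀
      t₀-fresh       : All (λ (t , _) → t₀ ≢ t) as
      assignable     : All Assignable as
      apart          : AllPairs Apart as
      inverse-closed : ∀ {t c} → (t , c) ∈ as → ∃[ t′ ] (t′ , inv c) ∈ as

  matchedTags : Elt G → List (Elt G × Elt G) → List (Elt G × Elt G)
  matchedTags t₀ as = (t₀ , e) ∷ (e , e) ∷ tags as

  assignmentMatching : Elt G → List (Elt G × Elt G) → List (Elt G × Elt G)
  assignmentMatching t₀ as = (enc (t₀ , e) , enc (e , e)) ∷ concatMap edgesOf as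

  vertices-assignmentMatching : ∀ t₀ as → vertices (assignmentMatching t₀ as) ≡ map enc (matchedTags t₀ as)
  vertices-assignmentMatching t₀ as = cong (λ vs → enc (t₀ , e) ∷ enc (e , e) ∷ vs) (begin
    vertices (concatMap edgesOf as)          ≡⟨ vertices-concatMap edgesOf as ⟩
    concatMap (λ a → map enc (tagsOf a)) as  ≡⟨ map-concatMap enc tagsOf as ⟨
    map enc (tags as)                        ∎)
    where open ≡-Reasoning

  module _ {t₀ as} (isAssignment : IsAssignment t₀ as) where
    open IsAssignment isAssignment

    private
      t₀·t₀≡e = proj₁ (involution⇒ t₀-involution)
      t₀≢e = proj₂ (involution⇒ t₀-involution)

      matchedTags-factorisation : All IsFactorisation (matchedTags t₀ as)
      matchedTags-factorisation = factorisation-·e t₀·t₀≡e ∷ factorisation-·e (identityˡ e) ∷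
        All.concat⁺ (All.map⁺ (All.map tagsOf-factorisation assignable))

      matchedTags-unique : Unique (matchedTags t₀ as)
      matchedTags-unique =
        (t₀≢e ∘ ,-injectiveˡ ∷ All.¬Any⇒All¬ _ t₀e∉) ∷ All.¬Any⇒All¬ _ ee∉ ∷ tags-unique assignable apart
        where
        t₀e∉ : (t₀ , e) ∉ tags as
        t₀e∉ t₀e∈ with ∈-tags⁻ t₀e∈
        ... | a , a∈as , t₀e∈a with ∈-tagsOf⁻ t₀e∈a
        ...   | inj₁ t₀≡t       = All.lookup t₀-fresh a∈as t₀≡t
        ...   | inj₂ (t₀≡e , _) = t₀≢e t₀≡e
        ee∉ : (e , e) ∉ tags as
        ee∉ ee∈ with ∈-tags⁻ ee∈
        ... | a , a∈as , ee∈a with All.lookup assignable a∈as | ∈-tagsOf⁻ ee∈a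
        ...   | t-inv , _   | inj₁ e≡t         = proj₂ (involution⇒ t-inv) (sym e≡t)
        ...   | _ , _ , c≢e | inj₂ (_ , e≡c⁻¹) = c≢e (⁻¹-injective (trans (sym e≡c⁻¹) (sym ε⁻¹≈ε)))

      matchedTags-inverseClosed : ∀ {x} → x ∈ matchedTags t₀ as → (proj₁ x , inv (proj₂ x)) ∈ matchedTags t₀ as
      matchedTags-inverseClosed (here refl)         = here (cong (t₀ ,_) ε⁻¹≈ε)
      matchedTags-inverseClosed (there (here refl)) = there (here (cong (e ,_) ε⁻¹≈ε))
      matchedTags-inverseClosed (there (there x∈))  = there (there (tags-inverseClosed inverse-closed x∈))

    assignmentMatching-isMatching : IsMatching G (assignmentMatching t₀ as)
    assignmentMatching-isMatching =
      adjacent-oddPart (factorisation-·e t₀·t₀≡e) t₀≢e ∷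
        All.concat⁺ (All.map⁺ (All.map edgesOf-adjacent assignable)) ,
      subst Unique (sym (vertices-assignmentMatching t₀ as))
        (map⁺-injectiveOn factorisation-unique matchedTags-factorisation matchedTags-unique)

    tag∈⇒enc∈vertices : ∀ {τ} → τ ∈ matchedTags t₀ as → enc τ ∈ vertices (assignmentMatching t₀ as)
    tag∈⇒enc∈vertices {τ} τ∈ = subst (enc τ ∈_) (sym (vertices-assignmentMatching t₀ as)) (∈-map⁺ enc τ∈)

    assignmentMatching-inverseClosed : ∀ {x} → x ∈ vertices (assignmentMatching t₀ as) →
                                       inv x ∈ vertices (assignmentMatching t₀ as)
    assignmentMatching-inverseClosed {x} x∈
      with ∈-map⁻ enc (subst (x ∈_) (vertices-assignmentMatching t₀ as) x∈)
    ... | τ , τ∈ , refl = subst (_∈ vertices (assignmentMatching t₀ as))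
      (sym (enc-inv (All.lookup matchedTags-factorisation τ∈))) (tag∈⇒enc∈vertices (matchedTags-inverseClosed τ∈))

  assign : List (Elt G) → List (Elt G) → List (Elt G × Elt G)
  assign (q ∷ qs) (a ∷ b ∷ ts) = (a , q) ∷ (b , inv q) ∷ assign qs ts
  assign _        _            = []

  unassigned : List (Elt G) → List (Elt G) → List (Elt G)
  unassigned []       ts           = ts
  unassigned (q ∷ qs) (a ∷ b ∷ ts) = unassigned qs ts
  unassigned (q ∷ qs) ts           = ts

  length-unassigned : ∀ qs ts →
    length (unassigned qs ts) ≤ 1 ⊎ 2 * length qs + length (unassigned qs ts) ≡ length ts
  length-unassigned []       ts           = inj₂ refl
  length-unassigned (q ∷ qs) []           = inj₁ z≤n
  length-unassigned (q ∷ qs) (a ∷ [])     = inj₁ (s≤s z≤n)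
  length-unassigned (q ∷ qs) (a ∷ b ∷ ts) with length-unassigned qs ts
  ... | inj₁ ≤1 = inj₁ ≤1
  ... | inj₂ eq = inj₂ (trans (cong (_+ length (unassigned qs ts)) (*-suc 2 (length qs))) (cong (2 +_) eq))

  ∈-assign⁻ : ∀ qs ts {x} → x ∈ assign qs ts → proj₁ x ∈ ts × proj₂ x ∈ vertices (pairWith qs)
  ∈-assign⁻ (q ∷ qs) (a ∷ b ∷ ts) (here refl)         = here refl , here refl
  ∈-assign⁻ (q ∷ qs) (a ∷ b ∷ ts) (there (here refl)) = there (here refl) , there (here refl)
  ∈-assign⁻ (q ∷ qs) (a ∷ b ∷ ts) (there (there x∈))  =
    let t∈ , c∈ = ∈-assign⁻ qs ts x∈ in there (there t∈) , there (there c∈)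

  assign-cover : ∀ qs ts {t} → t ∈ ts → (∃[ c ] (t , c) ∈ assign qs ts) ⊎ t ∈ unassigned qs ts
  assign-cover []       ts           t∈                  = inj₂ t∈
  assign-cover (q ∷ qs) (a ∷ [])     t∈                  = inj₂ t∈
  assign-cover (q ∷ qs) (a ∷ b ∷ ts) (here refl)         = inj₁ (q , here refl)
  assign-cover (q ∷ qs) (a ∷ b ∷ ts) (there (here refl)) = inj₁ (inv q , there (here refl))
  assign-cover (q ∷ qs) (a ∷ b ∷ ts) (there (there t∈)) with assign-cover qs ts t∈
  ... | inj₁ (c , tc∈) = inj₁ (c , there (there tc∈))
  ... | inj₂ t∈′       = inj₂ t∈′

  assign-inverseClosed : ∀ qs ts {t c} → (t , c) ∈ assign qs ts → ∃[ t′ ] (t′ , inv c) ∈ assign qs ts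
  assign-inverseClosed (q ∷ qs) (a ∷ b ∷ ts) (here refl)         = b , there (here refl)
  assign-inverseClosed (q ∷ qs) (a ∷ b ∷ ts) (there (here refl)) = a , here (cong (a ,_) (⁻¹-involutive q))
  assign-inverseClosed (q ∷ qs) (a ∷ b ∷ ts) (there (there tc∈)) =
    let t′ , t′c⁻¹∈ = assign-inverseClosed qs ts tc∈ in t′ , there (there t′c⁻¹∈)

  assign-apart : ∀ qs ts → Unique ts → Unique (vertices (pairWith qs)) → AllPairs Apart (assign qs ts)
  assign-apart []       ts           _ _ = []
  assign-apart (q ∷ qs) []           _ _ = []
  assign-apart (q ∷ qs) (a ∷ [])     _ _ = []
  assign-apart (q ∷ qs) (a ∷ b ∷ ts) ((a≢b ∷ a∉ts) ∷ b∉ts ∷ uts) ((q≢q⁻¹ ∷ q∉) ∷ q⁻¹∉ ∷ uqs) =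
    ((a≢b , q≢q⁻¹) ∷ All.tabulate (apart-from a∉ts q∉)) ∷ All.tabulate (apart-from b∉ts q⁻¹∉) ∷
    assign-apart qs ts uts uqs
    where
    apart-from : ∀ {t c} → All (t ≢_) ts → All (c ≢_) (vertices (pairWith qs)) →
                 ∀ {x} → x ∈ assign qs ts → Apart (t , c) x
    apart-from t∉ts c∉ x∈ = let t′∈ , c′∈ = ∈-assign⁻ qs ts x∈ in All.lookup t∉ts t′∈ , All.lookup c∉ c′∈

  below⇒≢e : ∀ {q} → Below q → q ≢ e
  below⇒≢e {q} q<q⁻¹ q≡e = below⇒≢ q<q⁻¹ (trans q≡e (trans (sym ε⁻¹≈ε) (cong inv (sym q≡e))))

  module OddCentralRepresentatives {LO} (enumO : Enumerates (InOddCentralizerOfInvolutions G) LO) where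
    open Equivalence

    reps : List (Elt G)
    reps = filter below? LO

    ∈-reps⁻ : ∀ {q} → q ∈ reps → InOddCentralizerOfInvolutions G q × Below q
    ∈-reps⁻ q∈ = let q∈LO , q-below = ∈-filter⁻ below? {xs = LO} q∈ in to (proj₂ enumO _) q∈LO , q-below

    reps-vertices-unique : Unique (vertices (pairWith reps))
    reps-vertices-unique = pairWith-unique (filter⁺ below? (proj₁ enumO)) (All.all-filter below? LO)

    length-LO≤ : length LO ≤ suc (2 * length reps)
    length-LO≤ = subst (length LO ≤_) length-e∷reps (unique-⊆⇒length≤ (proj₁ enumO) LO⊆e∷reps)
      where
      length-e∷reps : length (e ∷ vertices (pairWith reps)) ≡ suc (2 * length reps)
      length-e∷reps = cong suc (trans (length-vertices (pairWith reps)) (cong (2 *_) (length-map _ reps)))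
      LO⊆e∷reps : LO ⊆ e ∷ vertices (pairWith reps)
      LO⊆e∷reps {o} o∈LO with o ≟ e
      ... | yes o≡e = here o≡e
      ... | no  o≢e = there (∈-pairWith-filter (oddTorsion-≢inv (hasOddOrder⇒oddTorsion (proj₁ o-odd)) o≢e)
                                                o∈LO (from (proj₂ enumO _) (inOddCentralizer-inv o-odd)))
        where o-odd = to (proj₂ enumO o) o∈LO

    rep-assignable : ∀ {c} → c ∈ vertices (pairWith reps) → InOddCentralizerOfInvolutions G c × c ≢ e
    rep-assignable c∈ with ∈-pairWith⁻ c∈
    ... | q , q∈ , inj₁ refl = proj₁ (∈-reps⁻ q∈) , below⇒≢e (proj₂ (∈-reps⁻ q∈))
    ... | q , q∈ , inj₂ refl = inOddCentralizer-inv (proj₁ (∈-reps⁻ q∈)) ,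
      λ q⁻¹≡e → below⇒≢e (proj₂ (∈-reps⁻ q∈)) (⁻¹-injective (trans q⁻¹≡e (sym ε⁻¹≈ε)))

    assign-isAssignment : ∀ {t₀ ts} → Unique (t₀ ∷ ts) → All (Involution G) (t₀ ∷ ts) →
                          IsAssignment t₀ (assign reps ts)
    assign-isAssignment {t₀} {ts} (t₀∉ts ∷ uts) (t₀-inv ∷ ts-inv) = record
      { t₀-involution  = t₀-inv
      ; t₀-fresh       = All.tabulate (λ x∈ → All.lookup t₀∉ts (proj₁ (∈-assign⁻ reps ts x∈)))
      ; assignable     = All.tabulate λ x∈ →
                           let t∈ , c∈ = ∈-assign⁻ reps ts x∈ in All.lookup ts-inv t∈ , rep-assignable c∈
      ; apart          = assign-apart reps ts uts reps-vertices-unique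
      ; inverse-closed = assign-inverseClosed reps ts
      }

  unmatched≤ : ∀ M R → (∀ x → x ∈ vertices M ⊎ x ∈ R) → unmatched G M ≤ length R
  unmatched≤ M R cover = m≤n+o⇒m∸n≤o order (length (vertices M)) (covering⇒≤ (vertices M) R cover)

  unmatched≤1⇒≡0 : 2 ∣ order → ∀ M → unmatched G M ≤ 1 → unmatched G M ≡ 0
  unmatched≤1⇒≡0 2∣order M ≤1 = subst (λ k → order ∸ k ≡ 0) (sym (length-vertices M))
    (even∸even≤1⇒≡0 (length M) 2∣order (subst (λ k → order ∸ k ≤ 1) (length-vertices M) ≤1))

  matching-unmatched≤1⊎≤bound : ∀ LI LO →
    Enumerates (Involution G) LI → Enumerates (InOddCentralizerOfInvolutions G) LO →
    ∃[ M ] (IsMatching G M × (unmatched G M ≤ 1 ⊎ unmatched G M ≤ length LI ∸ length LO))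
  matching-unmatched≤1⊎≤bound [] LO (_ , enumI) _ =
    extended , extended-isMatching , inj₁ (unmatched≤ extended (e ∷ []) cover)
    where
    open InverseExtension [] ([] , []) (λ ())
    cover : ∀ x → x ∈ vertices extended ⊎ x ∈ e ∷ []
    cover x with extended-cover x
    ... | inj₁ x∈ = inj₁ x∈
    ... | inj₂ x²≡e with square≡e⇒≡e⊎involution x²≡e
    ...   | inj₁ x≡e   = inj₂ (here x≡e)
    ...   | inj₂ x-inv with () ← Equivalence.from (enumI x) x-inv
  matching-unmatched≤1⊎≤bound (t₀ ∷ ts) LO (uLI , enumI) enumO =
    extended , extended-isMatching ,
    Sum.map (≤-trans unmatched≤R) (≤-trans unmatched≤R ∘ R-bound) (length-unassigned reps ts)
    where
    open OddCentralRepresentatives enumO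
    as = assign reps ts

    isAssignment : IsAssignment t₀ as
    isAssignment = assign-isAssignment uLI (All.tabulate (λ t∈ → Equivalence.to (enumI _) t∈))

    open InverseExtension (assignmentMatching t₀ as) (assignmentMatching-isMatching isAssignment)
                          (assignmentMatching-inverseClosed isAssignment)

    R = unassigned reps ts

    tagged-or-unassigned : ∀ {x} → x · x ≡ e → (x , e) ∈ matchedTags t₀ as ⊎ x ∈ R
    tagged-or-unassigned x²≡e with square≡e⇒≡e⊎involution x²≡e
    ... | inj₁ refl = inj₁ (there (here refl))
    ... | inj₂ x-inv with Equivalence.from (enumI _) x-inv
    ...   | here refl = inj₁ (here refl)
    ...   | there x∈ts with assign-cover reps ts x∈ts
    ...     | inj₁ (c , xc∈) = inj₁ (there (there (∈-tags⁺ xc∈ (here refl))))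
    ...     | inj₂ x∈R       = inj₂ x∈R

    cover : ∀ x → x ∈ vertices extended ⊎ x ∈ R
    cover x with extended-cover x
    ... | inj₁ x∈ = inj₁ x∈
    ... | inj₂ x²≡e = Sum.map₁ (λ xe∈ → extended-⊇ (subst (_∈ _) (identityʳ x) (tag∈⇒enc∈vertices isAssignment xe∈)))
                                (tagged-or-unassigned x²≡e)

    unmatched≤R : unmatched G extended ≤ length R
    unmatched≤R = unmatched≤ extended R cover

    R-bound : 2 * length reps + length R ≡ length ts → length R ≤ length (t₀ ∷ ts) ∸ length LO
    R-bound eq = subst (_≤ suc (length ts) ∸ length LO)
      (trans (cong (_∸ 2 * length reps) (sym eq)) (m+n∸m≡n (2 * length reps) (length R)))
      (∸-monoʳ-≤ (suc (length ts)) length-LO≤)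

mainTheorem4 : (G : FiniteGroup) → 2 ∣ FiniteGroup.order G →
    (LI LO : List (Elt G)) →
    Enumerates (Involution G) LI →
    Enumerates (InOddCentralizerOfInvolutions G) LO →
    (∃[ M ] (IsMatching G M × unmatched G M ≤ length LI ∸ length LO))
    × (length LI ≤ length LO → ∃[ M ] IsPerfectMatching G M)
mainTheorem4 G 2∣order LI LO enumI enumO with PowerGraphMatching.matching-unmatched≤1⊎≤bound G LI LO enumI enumO
... | M , isMatching , bound = (M , isMatching , unmatched≤bound) , perfect
  where
  open PowerGraphMatching G

  unmatched≤bound : unmatched G M ≤ length LI ∸ length LO
  unmatched≤bound = Sum.[ (λ ≤1 → subst (_≤ length LI ∸ length LO) (sym (unmatched≤1⇒≡0 2∣order M ≤1)) z≤n)
                        , id ] bound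

  perfect : length LI ≤ length LO → ∃[ M ] IsPerfectMatching G M
  perfect LI≤LO = M , isMatching ,
    unique∧∸length≡0⇒∈ (proj₂ isMatching)
      (n≤0⇒n≡0 (≤-trans unmatched≤bound (≤-reflexive (m≤n⇒m∸n≡0 LI≤LO))))
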